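{- For all $n\geq2$, $\#O\Pi_n(13/2)=\#E\Pi_n(13/2)=2^{n-2}$.
   Context: $\Pi_n$ is the set of set partitions of $[n]=\{1,\dots,n\}$. For $\pi\in\Pi_m$ and $\sigma\in\Pi_n$, $\sigma$ contains the pattern $\pi$ if there is $S\subseteq[n]$ with $\#S=m$ such that the restriction $\{B\cap S: B\in\sigma,\ B\cap S\neq\emptyset\}$, relabeled by the order-preserving bijection $S\to[m]$, equals $\pi$; otherwise $\sigma$ avoids $\pi$. $\Pi_n(R)$ is the set of $\sigma\in\Pi_n$ avoiding every pattern in $R$. Here $13/2=\{\{1,3\},\{2\}\}$. The sign of $\sigma\in\Pi_n$ with $k$ blocks is $(-1)^{n-k}$; $\sigma$ is even if its sign is $1$ and odd if it is $-1$. $E\Pi_n(R)$ and $O\Pi_n(R)$ denote the sets of even, respectively odd, partitions in $\Pi_n(R)$. -}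

module Defs where

open import Data.Bool using (Bool; true; false; _∧_; if_then_else_; not)
open import Data.Nat using (ℕ; zero; suc; _∸_; _≤ᵇ_; _≡ᵇ_; _≟_; _%_)
open import Data.List using (List; []; _∷_; map; _++_; length; filterᵇ; deduplicate)
open import Data.Bool.ListAction using (any)
open import Data.List.Properties using (≡-dec)
open import Relation.Nullary.Decidable using (⌊_⌋)

-- Encoding of set partitions of [n] = {1,...,n}:
-- a set partition σ of [n] is encoded by its restricted growth word
-- w = w₁ … wₙ, where wᵢ is the (0-based) index of the block containing i,
-- blocks being numbered in increasing order of their minimal elements.
-- This is the standard bijection; i and j lie in the same block iff wᵢ = wⱼ.

-- restricted growth check: b = number of blocks opened so far
rgfAux : ℕ → List ℕ → Bool
rgfAux b []       = true
rgfAux b (x ∷ xs) = (x ≤ᵇ b) ∧ rgfAux (if x ≡ᵇ b then suc b else b) xs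

isRGF : List ℕ → Bool
isRGF = rgfAux 0

words : ℕ → ℕ → List (List ℕ)
words k zero    = [] ∷ []
words k (suc n) = concatMapW (words k n)
  where
  letters : ℕ → List ℕ
  letters zero    = []
  letters (suc j) = letters j ++ (j ∷ [])
  concatMapW : List (List ℕ) → List (List ℕ)
  concatMapW []       = []
  concatMapW (w ∷ ws) = map (λ x → x ∷ w) (letters k) ++ concatMapW ws

Π : ℕ → List (List ℕ)
Π n = filterᵇ isRGF (words n n)

blocks : List ℕ → ℕ
blocks w = length (deduplicate _≟_ w)

-- sign (-1)^(n-k): even iff n - k is even (here n = length w, k ≤ n)
isEvenPartition : List ℕ → Bool
isEvenPartition w = (length w ∸ blocks w) % 2 ≡ᵇ 0

isOddPartition : List ℕ → Bool
isOddPartition w = not (isEvenPartition w)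

-- all subsequences (restrictions to subsets S of positions)
sublists : List ℕ → List (List ℕ)
sublists []       = [] ∷ []
sublists (x ∷ xs) = map (x ∷_) (sublists xs) ++ sublists xs

indexOf : ℕ → List ℕ → ℕ
indexOf x []       = 0
indexOf x (y ∷ ys) = if x ≡ᵇ y then 0 else suc (indexOf x ys)

-- relabel a word so that blocks are numbered by order of first occurrence;
-- this is the order-preserving relabelling of the restricted partition
standardize : List ℕ → List ℕ
standardize w = map (λ x → indexOf x (deduplicate _≟_ w)) w

contains : List ℕ → List ℕ → Bool
contains σ π = any (λ s → ⌊ ≡-dec _≟_ (standardize s) π ⌋) (sublists σ)

avoids : List ℕ → List ℕ → Bool
avoids σ π = not (contains σ π)

p13/2 : List ℕ
p13/2 = 0 ∷ 1 ∷ 0 ∷ []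

Πavoid : ℕ → List (List ℕ)
Πavoid n = filterᵇ (λ σ → avoids σ p13/2) (Π n)

EΠ : ℕ → List (List ℕ)
EΠ n = filterᵇ isEvenPartition (Πavoid n)

OΠ : ℕ → List (List ℕ)
OΠ n = filterᵇ isOddPartition (Πavoid n)

{-# OPTIONS --safe #-}
module Submission where

open import Defs
open import Data.Nat using (ℕ; _≤_; _∸_; _^_)
open import Data.List using (length)
open import Data.Product using (_×_)
open import Relation.Binary.PropositionalEquality using (_≡_)

import Algebra.Properties.CommutativeSemigroup as CommSemigroup
open import Data.Bool using (Bool; true; false; T; not; _∧_; if_then_else_)
open import Data.Bool.Properties using (T-∧; T-≡; T-not-≡; not-involutive; not-¬)
open import Data.Empty using (⊥-elim)
open import Data.List using (List; []; _∷_; [_]; _++_; map; filterᵇ; deduplicate)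
open import Data.List.Membership.Propositional using (_∈_; find; lose)
open import Data.List.Membership.Propositional.Properties using (∈-map⁺; ∈-map⁻; ∈-++⁺ˡ; ∈-++⁺ʳ; ∈-++⁻)
open import Data.List.Properties using (map-++; map-∘; filter-all; filter-idem; filter-≐; length-filter; ++-assoc)
open import Data.List.Relation.Binary.Sublist.Propositional using (_⊆_; []; _∷_; _∷ʳ_; ⊆-refl; minimum)
open import Data.List.Relation.Binary.Sublist.Propositional.Properties using (All-resp-⊆; ++⁺; ++⁺ˡ; ++⁺ʳ)
open import Data.List.Relation.Unary.All as All using (All; []; _∷_)
open import Data.List.Relation.Unary.All.Properties using (deduplicate⁺)
open import Data.List.Relation.Unary.AllPairs using (AllPairs; []; _∷_)
open import Data.List.Relation.Unary.Any using (here)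
open import Data.List.Relation.Unary.Any.Properties using (any⁺; any⁻)
open import Data.Nat using (zero; suc; pred; >-nonZero; _+_; _<_; _≡ᵇ_; _%_; s≤s; z≤n)
open import Data.Nat.ListAction using (sum)
open import Data.Nat.ListAction.Properties using (sum-++)
open import Data.Nat.Properties
  using (_≟_; +-identityʳ; +-suc; +-∸-assoc; +-commutativeSemigroup; ≤-refl; ≤-trans; ≤-antisym;
         n≤1+n; n<1+n; pred[n]≤n; suc-pred; m<n⇒0<n; 1+n≢n; <⇒≢; ≤∧≢⇒<; m<1+n⇒m≤n; m≤m+n; ≤⇒≤ᵇ; ≤ᵇ⇒≤)
open import Data.Product using (∃₂; _,_; proj₁; proj₂)
open import Data.Sum using (inj₁; inj₂)
open import Function using (_∘_; _⇔_; mk⇔; Equivalence)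
open import Relation.Binary.PropositionalEquality
  using (_≢_; refl; sym; trans; cong; cong₂; subst; module ≡-Reasoning)
open import Relation.Nullary using (¬_; ¬?; yes; no; Reflects; ofʸ; ofⁿ; proof)
open import Relation.Nullary.Decidable using (T?; dec-true; dec-false; toWitness; fromWitness)
open import Relation.Unary using (_≐_)

open Equivalence using (to; from)

-- A restricted growth word avoids 13/2 exactly when it is weakly increasing, i.e. when each
-- letter after the leading 0 either repeats the last block or opens the next one.  The sign
-- of such a staircase word is the parity of its number of repeats, since n − #blocks counts
-- the elements that are not the first of their block.  A staircase continuation of length
-- r + 1 is a sequence of r + 1 such binary choices, the first of which flips (repeat) or keeps
-- (open) the parity of the rest; by induction on r both parity classes have 2^r elements.
-- The n − 1 choices after the leading 0 give 2^(n−2).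

-- `m ≟ n` is implemented by the test `m ≡ᵇ n`, so `does (m ≟ n)` reduces to it.
≡ᵇ-reflects : ∀ m n → Reflects (m ≡ n) (m ≡ᵇ n)
≡ᵇ-reflects m n = proof (m ≟ n)

≡ᵇ-refl : ∀ n → (n ≡ᵇ n) ≡ true
≡ᵇ-refl n = dec-true (n ≟ n) refl

≢⇒≡ᵇ≡false : ∀ {m n} → m ≢ n → (m ≡ᵇ n) ≡ false
≢⇒≡ᵇ≡false {m} {n} = dec-false (m ≟ n)

𝟙 : Bool → ℕ
𝟙 true  = 1
𝟙 false = 0

∑< : ℕ → (ℕ → ℕ) → ℕ
∑< zero    g = 0
∑< (suc k) g = ∑< k g + g k

syntax ∑< k (λ x → e) = ∑[ x < k ] e

∑<-cong : ∀ k {g h : ℕ → ℕ} → (∀ x → g x ≡ h x) → ∑< k g ≡ ∑< k h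
∑<-cong zero    g≗h = refl
∑<-cong (suc k) g≗h = cong₂ _+_ (∑<-cong k g≗h) (g≗h k)

∑<-vanishes : ∀ k {g : ℕ → ℕ} → (∀ x → x < k → g x ≡ 0) → ∑< k g ≡ 0
∑<-vanishes zero    g≡0 = refl
∑<-vanishes (suc k) g≡0 =
  cong₂ _+_ (∑<-vanishes k (λ x x<k → g≡0 x (≤-trans x<k (n≤1+n k)))) (g≡0 k ≤-refl)

∑<-distrib-+ : ∀ k (g h : ℕ → ℕ) → ∑[ x < k ] (g x + h x) ≡ ∑< k g + ∑< k h
∑<-distrib-+ zero    g h = refl
∑<-distrib-+ (suc k) g h =
  trans (cong (_+ (g k + h k)) (∑<-distrib-+ k g h))
        (CommSemigroup.interchange +-commutativeSemigroup (∑< k g) (∑< k h) (g k) (h k))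

∑<-comm : ∀ k j (g : ℕ → ℕ → ℕ) → ∑[ x < k ] ∑[ y < j ] g x y ≡ ∑[ y < j ] ∑[ x < k ] g x y
∑<-comm zero    j g = sym (∑<-vanishes j (λ _ _ → refl))
∑<-comm (suc k) j g =
  trans (cong (_+ ∑< j (g k)) (∑<-comm k j g))
        (sym (∑<-distrib-+ j (λ y → ∑[ x < k ] g x y) (g k)))

∑<-δ : ∀ {k a} α → a < k → ∑[ x < k ] (if x ≡ᵇ a then α else 0) ≡ α
∑<-δ {suc k} {a} α a<1+k with k ≡ᵇ a | ≡ᵇ-reflects k a
... | true  | ofʸ refl = cong (_+ α) (∑<-vanishes k off-a)
  where
  off-a : ∀ x → x < a → (if x ≡ᵇ a then α else 0) ≡ 0
  off-a x x<a rewrite ≢⇒≡ᵇ≡false (<⇒≢ x<a) = refl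
... | false | ofⁿ k≢a =
  trans (+-identityʳ _) (∑<-δ α (≤∧≢⇒< (m<1+n⇒m≤n a<1+k) (k≢a ∘ sym)))

∑words : ℕ → ℕ → (List ℕ → ℕ) → ℕ
∑words k zero    f = f []
∑words k (suc n) f = ∑[ x < k ] ∑words k n (λ w → f (x ∷ w))

∑words-zero : ∀ k n → ∑words k n (λ _ → 0) ≡ 0
∑words-zero k zero    = refl
∑words-zero k (suc n) = ∑<-vanishes k (λ _ _ → ∑words-zero k n)

∑words-∑< : ∀ k n j (g : ℕ → List ℕ → ℕ) →
  ∑words k n (λ w → ∑[ x < j ] g x w) ≡ ∑[ x < j ] ∑words k n (g x)
∑words-∑< k zero    j g = refl
∑words-∑< k (suc n) j g =
  trans (∑<-cong k (λ y → ∑words-∑< k n j (λ x w → g x (y ∷ w))))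
        (∑<-comm k j (λ y x → ∑words k n (λ w → g x (y ∷ w))))

-- `words` is built from two local helper functions of `Defs`, which cannot be named; the
-- metavariables below are solved by unification with them (the `with`s make the unification
-- problems patterns).
mutual
  extendWords : ℕ → ℕ → List (List ℕ) → List (List ℕ)
  extendWords = _

  words-suc : ∀ k n → words k (suc n) ≡ extendWords k n (words k n)
  words-suc k n with words k n
  ... | ws = refl

mutual
  letters : ℕ → ℕ → ℕ → List ℕ
  letters = _

  extendWords-∷ : ∀ k n w ws → extendWords (suc k) n (w ∷ ws) ≡
    map (_∷ w) (letters (suc k) n k ++ [ k ]) ++ extendWords (suc k) n ws
  extendWords-∷ k n w ws with suc k
  ... | _ = refl

sum-map-++ : ∀ {A : Set} (f : A → ℕ) xs ys → sum (map f (xs ++ ys)) ≡ sum (map f xs) + sum (map f ys)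
sum-map-++ f xs ys = trans (cong sum (map-++ f xs ys)) (sum-++ (map f xs) (map f ys))

sum-letters : ∀ k n j (g : ℕ → ℕ) → sum (map g (letters k n j)) ≡ ∑< j g
sum-letters k n zero    g = refl
sum-letters k n (suc j) g =
  trans (sum-map-++ g (letters k n j) [ j ]) (cong₂ _+_ (sum-letters k n j g) (+-identityʳ (g j)))

sum-extendWords : ∀ k n (f : List ℕ → ℕ) ws →
  sum (map f (extendWords k n ws)) ≡ sum (map (λ w → ∑[ x < k ] f (x ∷ w)) ws)
sum-extendWords k       n f []       = refl
sum-extendWords zero    n f (w ∷ ws) = sum-extendWords zero n f ws
sum-extendWords (suc k) n f (w ∷ ws) = begin
  sum (map f (extendWords (suc k) n (w ∷ ws)))
    ≡⟨ cong (sum ∘ map f) (extendWords-∷ k n w ws) ⟩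
  sum (map f (map (_∷ w) (letters (suc k) n (suc k)) ++ extendWords (suc k) n ws))
    ≡⟨ sum-map-++ f (map (_∷ w) (letters (suc k) n (suc k))) _ ⟩
  sum (map f (map (_∷ w) (letters (suc k) n (suc k)))) + sum (map f (extendWords (suc k) n ws))
    ≡⟨ cong₂ _+_ (trans (cong sum (sym (map-∘ (letters (suc k) n (suc k)))))
                        (sum-letters (suc k) n (suc k) (λ x → f (x ∷ w))))
                 (sum-extendWords (suc k) n f ws) ⟩
  ∑[ x < suc k ] f (x ∷ w) + sum (map (λ w → ∑[ x < suc k ] f (x ∷ w)) ws) ∎
  where open ≡-Reasoning

sum-words : ∀ k n (f : List ℕ → ℕ) → sum (map f (words k n)) ≡ ∑words k n f
sum-words k zero    f = +-identityʳ (f [])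
sum-words k (suc n) f = begin
  sum (map f (words k (suc n)))                            ≡⟨ cong (sum ∘ map f) (words-suc k n) ⟩
  sum (map f (extendWords k n (words k n)))                ≡⟨ sum-extendWords k n f (words k n) ⟩
  sum (map (λ w → ∑[ x < k ] f (x ∷ w)) (words k n))       ≡⟨ sum-words k n _ ⟩
  ∑words k n (λ w → ∑[ x < k ] f (x ∷ w))                  ≡⟨ ∑words-∑< k n k (λ x w → f (x ∷ w)) ⟩
  ∑[ x < k ] ∑words k n (λ w → f (x ∷ w))                  ∎
  where open ≡-Reasoning

length-filterᵇ : ∀ {A : Set} (p : A → Bool) xs → length (filterᵇ p xs) ≡ sum (map (𝟙 ∘ p) xs)
length-filterᵇ p []       = refl
length-filterᵇ p (x ∷ xs) with p x
... | true  = cong suc (length-filterᵇ p xs)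
... | false = length-filterᵇ p xs

filterᵇ-filterᵇ : ∀ {A : Set} (p q : A → Bool) xs →
  filterᵇ q (filterᵇ p xs) ≡ filterᵇ (λ x → p x ∧ q x) xs
filterᵇ-filterᵇ p q []       = refl
filterᵇ-filterᵇ p q (x ∷ xs) with p x
... | false = filterᵇ-filterᵇ p q xs
... | true  with q x
...   | true  = cong (x ∷_) (filterᵇ-filterᵇ p q xs)
...   | false = filterᵇ-filterᵇ p q xs

-- `staircase b e w`: reading `w` after a prefix that has opened the blocks 0, …, b − 1, every
-- letter either repeats the last block b − 1 or opens block b, and the number of repeats is
-- even iff `e`.
staircase : ℕ → Bool → List ℕ → Bool
staircase b e []       = e
staircase b e (x ∷ xs) = if suc x ≡ᵇ b then staircase b (not e) xs
                         else if x ≡ᵇ b then staircase (suc b) e xs else false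

∑words-staircase-∷ : ∀ k r b e x →
  ∑words k r (λ w → 𝟙 (staircase b e (x ∷ w))) ≡
  (if suc x ≡ᵇ b then ∑words k r (𝟙 ∘ staircase b (not e)) else 0) +
  (if x ≡ᵇ b then ∑words k r (𝟙 ∘ staircase (suc b) e) else 0)
∑words-staircase-∷ k r b e x with suc x ≡ᵇ b | ≡ᵇ-reflects (suc x) b | x ≡ᵇ b | ≡ᵇ-reflects x b
... | true  | ofʸ refl | true  | ofʸ x≡1+x = ⊥-elim (1+n≢n (sym x≡1+x))
... | true  | _        | false | _         = sym (+-identityʳ _)
... | false | _        | true  | _         = refl
... | false | _        | false | _         = ∑words-zero k r

∑words-staircase-suc : ∀ {k} r c e → suc c < k →
  ∑words k (suc r) (𝟙 ∘ staircase (suc c) e) ≡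
  ∑words k r (𝟙 ∘ staircase (suc c) (not e)) + ∑words k r (𝟙 ∘ staircase (suc (suc c)) e)
∑words-staircase-suc {k} r c e 1+c<k = begin
  ∑[ x < k ] ∑words k r (λ w → 𝟙 (staircase (suc c) e (x ∷ w)))
    ≡⟨ ∑<-cong k (∑words-staircase-∷ k r (suc c) e) ⟩
  ∑[ x < k ] ((if x ≡ᵇ c then A else 0) + (if x ≡ᵇ suc c then B else 0))
    ≡⟨ ∑<-distrib-+ k (λ x → if x ≡ᵇ c then A else 0) (λ x → if x ≡ᵇ suc c then B else 0) ⟩
  ∑[ x < k ] (if x ≡ᵇ c then A else 0) + ∑[ x < k ] (if x ≡ᵇ suc c then B else 0)
    ≡⟨ cong₂ _+_ (∑<-δ A (≤-trans (n≤1+n (suc c)) 1+c<k)) (∑<-δ B 1+c<k) ⟩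
  A + B ∎
  where
  open ≡-Reasoning
  A = ∑words k r (𝟙 ∘ staircase (suc c) (not e))
  B = ∑words k r (𝟙 ∘ staircase (suc (suc c)) e)

𝟙-not+𝟙 : ∀ e → 𝟙 (not e) + 𝟙 e ≡ 1
𝟙-not+𝟙 true  = refl
𝟙-not+𝟙 false = refl

∑words-staircase : ∀ {k} r c e → suc (suc (c + r)) ≤ k →
  ∑words k (suc r) (𝟙 ∘ staircase (suc c) e) ≡ 2 ^ r
∑words-staircase zero c e c+2≤k =
  trans (∑words-staircase-suc zero c e (≤-trans (s≤s (s≤s (m≤m+n c 0))) c+2≤k)) (𝟙-not+𝟙 e)
∑words-staircase {k} (suc r) c e c+r+3≤k = begin
  ∑words k (suc (suc r)) (𝟙 ∘ staircase (suc c) e)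
    ≡⟨ ∑words-staircase-suc (suc r) c e (≤-trans (s≤s (s≤s (m≤m+n c (suc r)))) c+r+3≤k) ⟩
  ∑words k (suc r) (𝟙 ∘ staircase (suc c) (not e)) + ∑words k (suc r) (𝟙 ∘ staircase (suc (suc c)) e)
    ≡⟨ cong₂ _+_ (∑words-staircase r c (not e) (≤-trans (n≤1+n _) bound))
                 (∑words-staircase r (suc c) e bound) ⟩
  2 ^ r + 2 ^ r
    ≡⟨ cong (2 ^ r +_) (sym (+-identityʳ (2 ^ r))) ⟩
  2 ^ suc r ∎
  where
  open ≡-Reasoning
  bound : suc (suc (suc c + r)) ≤ k
  bound = subst (λ m → suc (suc m) ≤ k) (+-suc c r) c+r+3≤k

∑words-staircase₀ : ∀ m e → ∑words (suc (suc m)) (suc (suc m)) (𝟙 ∘ staircase 0 e) ≡ 2 ^ m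
∑words-staircase₀ m e = begin
  ∑[ x < k ] ∑words k (suc m) (λ w → 𝟙 (staircase 0 e (x ∷ w)))
    ≡⟨ ∑<-cong k (∑words-staircase-∷ k (suc m) 0 e) ⟩
  ∑[ x < k ] (if x ≡ᵇ 0 then ∑words k (suc m) (𝟙 ∘ staircase 1 e) else 0)
    ≡⟨ ∑<-δ {k} _ (s≤s z≤n) ⟩
  ∑words k (suc m) (𝟙 ∘ staircase 1 e)
    ≡⟨ ∑words-staircase m 0 e ≤-refl ⟩
  2 ^ m ∎
  where
  open ≡-Reasoning
  k = suc (suc m)

staircase⇒rgf : ∀ b e w → T (staircase b e w) → T (rgfAux b w)
staircase⇒rgf b e []       _ = _
staircase⇒rgf b e (x ∷ xs) s with suc x ≡ᵇ b | ≡ᵇ-reflects (suc x) b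
... | true  | ofʸ refl rewrite ≢⇒≡ᵇ≡false (<⇒≢ (n<1+n x)) =
  from T-∧ (≤⇒≤ᵇ (n≤1+n x) , staircase⇒rgf (suc x) (not e) xs s)
... | false | _ with x ≡ᵇ b | ≡ᵇ-reflects x b
...   | true  | ofʸ refl = from T-∧ (≤⇒≤ᵇ (≤-refl {x}) , staircase⇒rgf (suc x) e xs s)

staircase⇒≥ : ∀ b e w → T (staircase b e w) → All (pred b ≤_) w
staircase⇒≥ b e []       _ = []
staircase⇒≥ b e (x ∷ xs) s with suc x ≡ᵇ b | ≡ᵇ-reflects (suc x) b
... | true  | ofʸ refl = ≤-refl ∷ staircase⇒≥ (suc x) (not e) xs s
... | false | _ with x ≡ᵇ b | ≡ᵇ-reflects x b
...   | true  | ofʸ refl = pred[n]≤n ∷ All.map (≤-trans pred[n]≤n) (staircase⇒≥ (suc x) e xs s)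

staircase⇒sorted : ∀ b e w → T (staircase b e w) → AllPairs _≤_ w
staircase⇒sorted b e []       _ = []
staircase⇒sorted b e (x ∷ xs) s with suc x ≡ᵇ b | ≡ᵇ-reflects (suc x) b
... | true  | ofʸ refl = staircase⇒≥ (suc x) (not e) xs s ∷ staircase⇒sorted (suc x) (not e) xs s
... | false | _ with x ≡ᵇ b | ≡ᵇ-reflects x b
...   | true  | ofʸ refl = staircase⇒≥ (suc x) e xs s ∷ staircase⇒sorted (suc x) e xs s

Has13/2 : List ℕ → Set
Has13/2 w = ∃₂ λ a c → a ≢ c × a ∷ c ∷ a ∷ [] ⊆ w

AllPairs-resp-⊆ : ∀ {A : Set} {R : A → A → Set} {xs ys} → xs ⊆ ys → AllPairs R ys → AllPairs R xs
AllPairs-resp-⊆ []          []       = []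
AllPairs-resp-⊆ (y ∷ʳ τ)    (_ ∷ rs) = AllPairs-resp-⊆ τ rs
AllPairs-resp-⊆ (refl ∷ τ)  (r ∷ rs) = All-resp-⊆ τ r ∷ AllPairs-resp-⊆ τ rs

sorted⇒¬13/2 : ∀ {w} → AllPairs _≤_ w → ¬ Has13/2 w
sorted⇒¬13/2 sorted (a , c , a≢c , τ) with AllPairs-resp-⊆ τ sorted
... | (a≤c ∷ _) ∷ (c≤a ∷ []) ∷ _ = a≢c (≤-antisym a≤c c≤a)

∈-sublists⁺ : ∀ {s w} → s ⊆ w → s ∈ sublists w
∈-sublists⁺             []         = here refl
∈-sublists⁺ {w = y ∷ w} (_ ∷ʳ τ)   = ∈-++⁺ʳ (map (y ∷_) (sublists w)) (∈-sublists⁺ τ)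
∈-sublists⁺             (refl ∷ τ) = ∈-++⁺ˡ (∈-map⁺ (_ ∷_) (∈-sublists⁺ τ))

∈-sublists⁻ : ∀ {s} w → s ∈ sublists w → s ⊆ w
∈-sublists⁻ []       (here refl) = []
∈-sublists⁻ (y ∷ w)  s∈ with ∈-++⁻ (map (y ∷_) (sublists w)) s∈
... | inj₁ s∈map with ∈-map⁻ (y ∷_) s∈map
...   | _ , s′∈ , refl = refl ∷ ∈-sublists⁻ w s′∈
∈-sublists⁻ (y ∷ w)  s∈ | inj₂ s∈′ = y ∷ʳ ∈-sublists⁻ w s∈′

standardize≡13/2 : ∀ s → standardize s ≡ p13/2 → ∃₂ λ a c → a ≢ c × s ≡ a ∷ c ∷ a ∷ []
standardize≡13/2 (a ∷ c ∷ a′ ∷ []) h with c ≡ᵇ a | ≡ᵇ-reflects c a | a′ ≡ᵇ a | ≡ᵇ-reflects a′ a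
standardize≡13/2 (a ∷ c ∷ a′ ∷ []) () | true  | _ | _     | _
standardize≡13/2 (a ∷ c ∷ a′ ∷ []) () | false | _ | false | _
... | false | ofⁿ c≢a | true | ofʸ refl = a , c , c≢a ∘ sym , refl

standardize-aca : ∀ {a c} → a ≢ c → standardize (a ∷ c ∷ a ∷ []) ≡ p13/2
standardize-aca {a} {c} a≢c
  rewrite ≡ᵇ-refl a | ≢⇒≡ᵇ≡false (a≢c ∘ sym) | ≢⇒≡ᵇ≡false a≢c | ≡ᵇ-refl c = refl

contains13/2⇔Has13/2 : ∀ w → T (contains w p13/2) ⇔ Has13/2 w
contains13/2⇔Has13/2 w = mk⇔ occurrence witness
  where
  occurrence : T (contains w p13/2) → Has13/2 w
  occurrence h with find (any⁻ _ (sublists w) h)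
  ... | s , s∈ , std with standardize≡13/2 s (toWitness std)
  ...   | a , c , a≢c , refl = a , c , a≢c , ∈-sublists⁻ w s∈
  witness : Has13/2 w → T (contains w p13/2)
  witness (a , c , a≢c , τ) = any⁺ _ (lose (∈-sublists⁺ τ) (fromWitness (standardize-aca a≢c)))

avoids13/2⇔¬Has13/2 : ∀ w → T (avoids w p13/2) ⇔ (¬ Has13/2 w)
avoids13/2⇔¬Has13/2 w with contains w p13/2 | contains13/2⇔Has13/2 w
... | true  | contains⇔ = mk⇔ (λ ()) (λ ¬has → ¬has (to contains⇔ _))
... | false | contains⇔ = mk⇔ (λ _ → from contains⇔) _

blocks≤length : ∀ w → blocks w ≤ length w
blocks≤length []       = z≤n
blocks≤length (x ∷ xs) =
  s≤s (≤-trans (length-filter (λ y → ¬? (x ≟ y)) (deduplicate _≟_ xs)) (blocks≤length xs))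

blocks-∷-repeat : ∀ x v → blocks (x ∷ x ∷ v) ≡ blocks (x ∷ v)
blocks-∷-repeat x v rewrite ≡ᵇ-refl x =
  cong (suc ∘ length) (filter-idem (λ y → ¬? (x ≟ y)) (deduplicate _≟_ v))

blocks-∷-new : ∀ {x v} → All (x ≢_) v → blocks (x ∷ v) ≡ suc (blocks v)
blocks-∷-new x∉v = cong (suc ∘ length) (filter-all (λ y → ¬? (_ ≟ y)) (deduplicate⁺ _≟_ x∉v))

isEven : ℕ → Bool
isEven m = m % 2 ≡ᵇ 0

isEven-suc : ∀ m → isEven (suc m) ≡ not (isEven m)
isEven-suc zero          = refl
isEven-suc (suc zero)    = refl
isEven-suc (suc (suc m)) = isEven-suc m

isEvenPartition-∷-repeat : ∀ x v → isEvenPartition (x ∷ x ∷ v) ≡ not (isEvenPartition (x ∷ v))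
isEvenPartition-∷-repeat x v = begin
  isEven (suc (suc (length v)) ∸ blocks (x ∷ x ∷ v))  ≡⟨ cong (λ B → isEven (suc (suc (length v)) ∸ B)) (blocks-∷-repeat x v) ⟩
  isEven (suc (suc (length v)) ∸ blocks (x ∷ v))      ≡⟨ cong isEven (+-∸-assoc 1 (blocks≤length (x ∷ v))) ⟩
  isEven (suc (suc (length v) ∸ blocks (x ∷ v)))      ≡⟨ isEven-suc (suc (length v) ∸ blocks (x ∷ v)) ⟩
  not (isEvenPartition (x ∷ v))                       ∎
  where open ≡-Reasoning

isEvenPartition-∷-new : ∀ {x v} → All (x ≢_) v → isEvenPartition (x ∷ v) ≡ isEvenPartition v
isEvenPartition-∷-new {x} {v} x∉v = cong (λ B → isEven (suc (length v) ∸ B)) (blocks-∷-new x∉v)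

staircase⇒parity : ∀ x e v → T (staircase (suc x) e v) → isEvenPartition (x ∷ v) ≡ e
staircase⇒parity x true  []      _ = refl
staircase⇒parity x e     (y ∷ v) s with y ≡ᵇ x | ≡ᵇ-reflects y x
... | true  | ofʸ refl = begin
  isEvenPartition (x ∷ x ∷ v)      ≡⟨ isEvenPartition-∷-repeat x v ⟩
  not (isEvenPartition (x ∷ v))    ≡⟨ cong not (staircase⇒parity x (not e) v s) ⟩
  not (not e)                      ≡⟨ not-involutive e ⟩
  e                                ∎
  where open ≡-Reasoning
... | false | _ with y ≡ᵇ suc x | ≡ᵇ-reflects y (suc x)
...   | true  | ofʸ refl =
  trans (isEvenPartition-∷-new x∉) (staircase⇒parity (suc x) e v s)
  where
  x∉ : All (x ≢_) (suc x ∷ v)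
  x∉ = <⇒≢ (n<1+n x) ∷ All.map <⇒≢ (staircase⇒≥ (suc (suc x)) e v s)

staircase₀⇒parity : ∀ e w → T (staircase 0 e w) → isEvenPartition w ≡ e
staircase₀⇒parity true []      _ = refl
staircase₀⇒parity e    (x ∷ v) s with x ≡ᵇ 0 | ≡ᵇ-reflects x 0
... | true | ofʸ refl = staircase⇒parity 0 e v s

OpenedBlocks : ℕ → List ℕ → Set
OpenedBlocks b u = (∀ {y} → y < b → [ y ] ⊆ u) × (∀ {y} → suc y < b → y ∷ pred b ∷ [] ⊆ u)

rgf∧¬staircase⇒13/2 : ∀ {b u} w e → OpenedBlocks b u → T (rgfAux b w) →
  ¬ T (staircase b e w) → ¬ T (staircase b (not e) w) → Has13/2 (u ++ w)
rgf∧¬staircase⇒13/2 []      true  _ _ ¬s _  = ⊥-elim (¬s _)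
rgf∧¬staircase⇒13/2 []      false _ _ _  ¬s = ⊥-elim (¬s _)
rgf∧¬staircase⇒13/2 {b} {u} (x ∷ w) e (opened , precedes) r ¬s ¬s′
  with x ≡ᵇ b | ≡ᵇ-reflects x b | suc x ≡ᵇ b | ≡ᵇ-reflects (suc x) b
... | true  | ofʸ refl | true  | ofʸ 1+x≡x = ⊥-elim (1+n≢n 1+x≡x)
... | true  | ofʸ refl | false | _ =
  subst Has13/2 (++-assoc u [ x ] w)
    (rgf∧¬staircase⇒13/2 w e (opened′ , precedes′) (proj₂ (to T-∧ r)) ¬s ¬s′)
  where
  opened′ : ∀ {y} → y < suc x → [ y ] ⊆ u ++ [ x ]
  opened′ {y} y<1+x with y ≟ x
  ... | yes refl = ++⁺ˡ u ⊆-refl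
  ... | no  y≢x  = ++⁺ʳ [ x ] (opened (≤∧≢⇒< (m<1+n⇒m≤n y<1+x) y≢x))
  precedes′ : ∀ {y} → suc y < suc x → y ∷ x ∷ [] ⊆ u ++ [ x ]
  precedes′ (s≤s y<x) = ++⁺ (opened y<x) ⊆-refl
... | false | _ | true  | ofʸ refl =
  subst Has13/2 (++-assoc u [ x ] w)
    (rgf∧¬staircase⇒13/2 w (not e) (++⁺ʳ [ x ] ∘ opened , ++⁺ʳ [ x ] ∘ precedes) (proj₂ (to T-∧ r)) ¬s ¬s′)
... | false | ofⁿ x≢b | false | ofⁿ 1+x≢b =
  x , pred b , x≢pred[b] , ++⁺ (precedes 1+x<b) (refl ∷ minimum w)
  where
  x<b : x < b
  x<b = ≤∧≢⇒< (≤ᵇ⇒≤ x b (proj₁ (to T-∧ r))) x≢b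
  1+x<b : suc x < b
  1+x<b = ≤∧≢⇒< x<b 1+x≢b
  x≢pred[b] : x ≢ pred b
  x≢pred[b] x≡pred[b] = 1+x≢b (trans (cong suc x≡pred[b]) (suc-pred b {{>-nonZero (m<n⇒0<n x<b)}}))

hasParity : Bool → List ℕ → Bool
hasParity true  = isEvenPartition
hasParity false = isOddPartition

T-hasParity : ∀ e w → T (hasParity e w) ⇔ isEvenPartition w ≡ e
T-hasParity true  w = T-≡
T-hasParity false w = T-not-≡

avoider-of-parity≐staircase₀ : ∀ e →
  (λ w → T ((isRGF w ∧ avoids w p13/2) ∧ hasParity e w)) ≐ (λ w → T (staircase 0 e w))
avoider-of-parity≐staircase₀ e = avoider⇒staircase , staircase⇒avoider
  where
  staircase⇒avoider : ∀ {w} → T (staircase 0 e w) → T ((isRGF w ∧ avoids w p13/2) ∧ hasParity e w)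
  staircase⇒avoider {w} s = from T-∧
    ( from T-∧ ( staircase⇒rgf 0 e w s
               , from (avoids13/2⇔¬Has13/2 w) (sorted⇒¬13/2 (staircase⇒sorted 0 e w s)))
    , from (T-hasParity e w) (staircase₀⇒parity e w s))

  avoider⇒staircase : ∀ {w} → T ((isRGF w ∧ avoids w p13/2) ∧ hasParity e w) → T (staircase 0 e w)
  avoider⇒staircase {w} h with to T-∧ h
  ... | rgf∧avoids , parity with to T-∧ rgf∧avoids | T? (staircase 0 e w) | T? (staircase 0 (not e) w)
  ...   | _   , _      | yes s  | _        = s
  ...   | _   , _      | no _   | yes s′   =
    ⊥-elim (not-¬ (to (T-hasParity e w) parity) (staircase₀⇒parity (not e) w s′))
  ...   | rgf , avoids | no ¬s  | no ¬s′   =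
    ⊥-elim (to (avoids13/2⇔¬Has13/2 w) avoids (rgf∧¬staircase⇒13/2 w e ((λ ()) , (λ ())) rgf ¬s ¬s′))

avoiders-of-parity : ∀ m e → length (filterᵇ (hasParity e) (Πavoid (suc (suc m)))) ≡ 2 ^ m
avoiders-of-parity m e = begin
  length (filterᵇ (hasParity e) (filterᵇ (λ w → avoids w p13/2) (filterᵇ isRGF W)))
    ≡⟨ cong (length ∘ filterᵇ (hasParity e)) (filterᵇ-filterᵇ isRGF (λ w → avoids w p13/2) W) ⟩
  length (filterᵇ (hasParity e) (filterᵇ (λ w → isRGF w ∧ avoids w p13/2) W))
    ≡⟨ cong length (filterᵇ-filterᵇ (λ w → isRGF w ∧ avoids w p13/2) (hasParity e) W) ⟩
  length (filterᵇ (λ w → (isRGF w ∧ avoids w p13/2) ∧ hasParity e w) W)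
    ≡⟨ cong length (filter-≐ _ _ (avoider-of-parity≐staircase₀ e) W) ⟩
  length (filterᵇ (staircase 0 e) W)
    ≡⟨ length-filterᵇ (staircase 0 e) W ⟩
  sum (map (𝟙 ∘ staircase 0 e) W)
    ≡⟨ sum-words n n (𝟙 ∘ staircase 0 e) ⟩
  ∑words n n (𝟙 ∘ staircase 0 e)
    ≡⟨ ∑words-staircase₀ m e ⟩
  2 ^ m ∎
  where
  open ≡-Reasoning
  n = suc (suc m)
  W = words n n

proposition4p5 : (n : ℕ) → 2 ≤ n →
    (length (OΠ n) ≡ 2 ^ (n ∸ 2)) × (length (EΠ n) ≡ 2 ^ (n ∸ 2))
proposition4p5 (suc (suc m)) (s≤s (s≤s z≤n)) = avoiders-of-parity m false , avoiders-of-parity m true
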